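{- Let $d>k\ge1$. Then $G_{d,k}(x_1,\dots,x_{d-1},0)=G_{d-1,k}(x_1,\dots,x_{d-1})$.
   Context: For $d\ge k\ge1$: a $k$-subset of $\{1,\dots,d\}$ is a $(d,k)$-direction. A $\binom{d}{k}$-ary tree is a rooted tree in which each child of a vertex is indexed by a $(d,k)$-direction, distinct children of a same vertex having distinct indices; the direction of a non-root vertex is its index. A non-ambiguous tree of dimension $(d,k)$ is a (non-empty) $\binom{d}{k}$-ary tree whose vertices carry labels in $(\mathbb{N}\cup\{\bullet\})^d$ such that: (1) a vertex of direction $\pi$ is labelled by a $d$-tuple whose non-$\bullet$ entries are exactly those in positions $i\in\pi$, and the root is labelled by a $d$-tuple with no $\bullet$; (2) if $U$ is a descendant of $V$ and the $i$-th components of $U$ and $V$ are both different from $\bullet$, then the $i$-th component of $V$ is strictly greater than that of $U$; (3) for each $i$, the $i$-th components different from $\bullet$ of all vertices are pairwise distinct and form an interval of integers with minimum $1$. $G_{d,k}(x_1,\dots,x_d)=\sum_N\prod_{i=1}^d x_i^{w_i(N)-1}/(w_i(N)-1)!$, summed over all non-ambiguous trees $N$ of dimension $(d,k)$, with $(w_1(N),\dots,w_d(N))$ the root label of $N$. -}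

module Defs where

open import Data.Nat using (ℕ; zero; suc; _<_; _≤_)
open import Data.Bool using (true; false)
open import Data.Maybe using (Maybe; just; nothing)
open import Data.Vec using (Vec; []; _∷_; lookup; map; _∷ʳ_)
open import Data.Fin using (Fin)
open import Data.Fin.Subset using (Subset; _∈_; _∉_; ∣_∣)
open import Data.List using (List; []; _∷_; _++_)
open import Data.Product using (Σ; ∃; _×_; _,_)
open import Relation.Binary.PropositionalEquality using (_≡_; _≢_)

-- A total map from subsets of {0..n-1} (i.e. Subset n = Vec Bool n) to A,
-- stored as a complete binary trie (canonical representation, no funext needed).
data Trie (A : Set) : ℕ → Set where
  leaf : A → Trie A zero
  node : ∀ {n} → Trie A n → Trie A n → Trie A (suc n)

lookupT : ∀ {A n} → Trie A n → Subset n → A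
lookupT (leaf a) [] = a
lookupT (node t₀ t₁) (false ∷ s) = lookupT t₀ s
lookupT (node t₀ t₁) (true ∷ s) = lookupT t₁ s

-- Raw (unconstrained) rooted trees whose children are indexed by subsets of
-- {1..d}: each index carries at most one child (nothing = no child).
-- Labels are d-tuples in (ℕ ∪ {•}); • is represented by nothing.
data RTree (d : ℕ) : Set where
  mk : Vec (Maybe ℕ) d → Trie (Maybe (RTree d)) d → RTree d

label : ∀ {d} → RTree d → Vec (Maybe ℕ) d
label (mk l _) = l

child : ∀ {d} → RTree d → Subset d → Maybe (RTree d)
child (mk _ ch) π = lookupT ch π

-- vertices are addressed by paths from the root (lists of child indices)
mutual
  at : ∀ {d} → RTree d → List (Subset d) → Maybe (RTree d)
  at t [] = just t
  at (mk _ ch) (π ∷ p) = atT ch π p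

  atT : ∀ {d n} → Trie (Maybe (RTree d)) n → Subset n → List (Subset d) → Maybe (RTree d)
  atT (leaf nothing) [] p = nothing
  atT (leaf (just c)) [] p = at c p
  atT (node t₀ t₁) (false ∷ s) p = atT t₀ s p
  atT (node t₀ t₁) (true ∷ s) p = atT t₁ s p

record NonAmbiguous (d k : ℕ) (N : RTree d) : Set where
  field
    rootFull : ∀ i → ∃ λ a → lookup (label N) i ≡ just a
    childDir : ∀ p u π c → at N p ≡ just u → child u π ≡ just c →
               ∣ π ∣ ≡ k ×
               (∀ i → (i ∈ π → ∃ λ a → lookup (label c) i ≡ just a) ×
                      (i ∉ π → lookup (label c) i ≡ nothing))
    decreasing : ∀ p q u v i a b → at N p ≡ just v → at N (p ++ q) ≡ just u →
                 q ≢ [] → lookup (label v) i ≡ just a → lookup (label u) i ≡ just b →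
                 b < a
    -- (3) non-• i-th entries pairwise distinct (distinct vertices = distinct paths) ...
    distinct : ∀ i p q u v a → at N p ≡ just u → at N q ≡ just v →
               lookup (label u) i ≡ just a → lookup (label v) i ≡ just a → p ≡ q
    interval : ∀ i → ∃ λ m → ∀ a →
               ((1 ≤ a × a ≤ m) → ∃ λ p → ∃ λ u → at N p ≡ just u × lookup (label u) i ≡ just a) ×
               ((∃ λ p → ∃ λ u → at N p ≡ just u × lookup (label u) i ≡ just a) → 1 ≤ a × a ≤ m)

NATreeWithRoot : (d k : ℕ) → Vec ℕ d → RTree d → Set
NATreeWithRoot d k w N = NonAmbiguous d k N × label N ≡ map just w

Equinumerous : ∀ {A B : Set} → (A → Set) → (B → Set) → Set
Equinumerous {A} {B} P Q =
  Σ (A → B) λ f → Σ (B → A) λ g →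
    (∀ x → P x → Q (f x) × g (f x) ≡ x) ×
    (∀ y → Q y → P (g y) × f (g y) ≡ y)

-- Coefficient-wise reading of G_{d,k}(x_1,…,x_{d-1},0) = G_{d-1,k}(x_1,…,x_{d-1}):
-- for every exponent vector, the set of (d,k)-trees with root label (w,1) and the set
-- of (d-1,k)-trees with root label w have the same cardinality.

{-# OPTIONS --safe #-}
module Submission where

open import Defs
open import Data.Bool using (Bool)
open import Data.Nat using (ℕ; zero; suc; _≤_; _<_; s≤s; z≤n)
open import Data.Nat.Properties using (≤-antisym; <⇒≱)
open import Data.Maybe using (Maybe; just; nothing; _>>=_) renaming (map to mapᵐ)
open import Data.Vec using (Vec; []; _∷_; _∷ʳ_; lookup; map; init; last; initLast)
open import Data.Vec.Properties using (init-∷ʳ; last-∷ʳ; map-∷ʳ; ∷ʳ-injectiveˡ; []=⇒lookup; lookup⇒[]=)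
open import Data.Fin using (Fin; zero; suc; inject₁; fromℕ)
open import Data.Fin.Subset using (Subset; _∈_; _∉_; ∣_∣; inside; outside)
open import Data.List using (List; []; _∷_; _++_) renaming (map to mapˡ)
open import Data.List.Properties using (map-++; map-injective; ∷-injective; ++-conicalʳ)
open import Data.Product using (∃; ∃₂; _×_; _,_; proj₁; proj₂; map₂)
open import Data.Empty using (⊥-elim)
open import Function using (_∘_)
open import Function.Definitions using (Injective)
open import Relation.Binary.PropositionalEquality

-- The last entry of the root is the largest last entry in the tree (condition (2)) and every last
-- entry is at least 1 (condition (3)). So if the root has last entry 1, no other vertex has a last
-- entry, hence no direction contains the last coordinate, and deleting that coordinate everywhere
-- leaves a non-ambiguous tree of dimension one lower. Conversely, appending 1 to the root label and
-- • to every other label turns a tree of dimension (d,k) into one of dimension (d+1,k) with root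
-- entry 1, and the two operations are mutually inverse.

private variable
  A B : Set
  n d k : ℕ

lookup-∷ʳ-inject₁ : (xs : Vec A n) (x : A) (i : Fin n) → lookup (xs ∷ʳ x) (inject₁ i) ≡ lookup xs i
lookup-∷ʳ-inject₁ (y ∷ xs) x zero    = refl
lookup-∷ʳ-inject₁ (y ∷ xs) x (suc i) = lookup-∷ʳ-inject₁ xs x i

lookup-∷ʳ-fromℕ : (xs : Vec A n) (x : A) → lookup (xs ∷ʳ x) (fromℕ n) ≡ x
lookup-∷ʳ-fromℕ []       x = refl
lookup-∷ʳ-fromℕ (y ∷ xs) x = lookup-∷ʳ-fromℕ xs x

lookup-init : (v : Vec A (suc n)) (i : Fin n) → lookup (init v) i ≡ lookup v (inject₁ i)
lookup-init v i with initLast v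
... | xs , x , refl = sym (lookup-∷ʳ-inject₁ xs x i)

lookup-fromℕ : (v : Vec A (suc n)) → lookup v (fromℕ n) ≡ last v
lookup-fromℕ v with initLast v
... | xs , x , refl = lookup-∷ʳ-fromℕ xs x

init-∷ʳ-last : (v : Vec A (suc n)) → init v ∷ʳ last v ≡ v
init-∷ʳ-last v with initLast v
... | xs , x , refl = refl

data InjectOrLast : Fin (suc n) → Set where
  injected  : (j : Fin n) → InjectOrLast (inject₁ j)
  lastIndex : InjectOrLast (fromℕ n)

injectOrLast : (i : Fin (suc n)) → InjectOrLast i
injectOrLast {zero}  zero    = lastIndex
injectOrLast {suc n} zero    = injected zero
injectOrLast {suc n} (suc i) with injectOrLast i
... | injected j = injected (suc j)
... | lastIndex  = lastIndex

∈-∷ʳ-inject₁⁻ : (π : Subset n) (b : Bool) (j : Fin n) → inject₁ j ∈ π ∷ʳ b → j ∈ π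
∈-∷ʳ-inject₁⁻ π b j j∈ = lookup⇒[]= j π (trans (sym (lookup-∷ʳ-inject₁ π b j)) ([]=⇒lookup j∈))

∈-∷ʳ-inject₁⁺ : (π : Subset n) (b : Bool) (j : Fin n) → j ∈ π → inject₁ j ∈ π ∷ʳ b
∈-∷ʳ-inject₁⁺ π b j j∈ =
  lookup⇒[]= (inject₁ j) (π ∷ʳ b) (trans (lookup-∷ʳ-inject₁ π b j) ([]=⇒lookup j∈))

fromℕ∈-∷ʳ-inside : (π : Subset n) → fromℕ n ∈ π ∷ʳ inside
fromℕ∈-∷ʳ-inside {n} π = lookup⇒[]= (fromℕ n) (π ∷ʳ inside) (lookup-∷ʳ-fromℕ π inside)

fromℕ∉-∷ʳ-outside : (π : Subset n) → fromℕ n ∉ π ∷ʳ outside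
fromℕ∉-∷ʳ-outside π n∈ with trans (sym (lookup-∷ʳ-fromℕ π outside)) ([]=⇒lookup n∈)
... | ()

∣∷ʳ-outside∣ : (π : Subset n) → ∣ π ∷ʳ outside ∣ ≡ ∣ π ∣
∣∷ʳ-outside∣ []            = refl
∣∷ʳ-outside∣ (inside ∷ π)  = cong suc (∣∷ʳ-outside∣ π)
∣∷ʳ-outside∣ (outside ∷ π) = ∣∷ʳ-outside∣ π

map≡just⁻ : (f : A → B) (m : Maybe A) {b : B} → mapᵐ f m ≡ just b →
            ∃ λ a → m ≡ just a × f a ≡ b
map≡just⁻ f (just a) refl = a , refl , refl

>>=≡just⁻ : {f : A → Maybe B} (m : Maybe A) {b : B} → (m >>= f) ≡ just b →
            ∃ λ a → m ≡ just a × f a ≡ just b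
>>=≡just⁻ (just a) fa≡b = a , refl , fa≡b

++-[x]≢[] : (xs : List A) (x : A) → xs ++ x ∷ [] ≢ []
++-[x]≢[] []      x ()
++-[x]≢[] (_ ∷ _) x ()

map≢[] : {f : A → B} (xs : List A) → xs ≢ [] → mapˡ f xs ≢ []
map≢[] []      xs≢[] = ⊥-elim (xs≢[] refl)
map≢[] (_ ∷ _) xs≢[] ()

map-++-split : {f : A → B} → Injective _≡_ _≡_ f → (xs : List A) (ys : List B) (zs : List A) →
               mapˡ f xs ++ ys ≡ mapˡ f zs → ∃ λ ys′ → ys ≡ mapˡ f ys′ × zs ≡ xs ++ ys′
map-++-split f-inj []       ys zs       eq = zs , eq , refl
map-++-split f-inj (x ∷ xs) ys (z ∷ zs) eq with ∷-injective eq
... | fx≡fz , eq′ with map-++-split f-inj xs ys zs eq′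
... | ys′ , refl , refl = ys′ , refl , cong (_∷ xs ++ ys′) (sym (f-inj fx≡fz))

atT-lookupT : (ch : Trie (Maybe (RTree d)) n) (π : Subset n) (p : List (Subset d)) →
              atT ch π p ≡ (lookupT ch π >>= λ c → at c p)
atT-lookupT (leaf nothing)  []            p = refl
atT-lookupT (leaf (just c)) []            p = refl
atT-lookupT (node t₀ t₁)    (outside ∷ π) p = atT-lookupT t₀ π p
atT-lookupT (node t₀ t₁)    (inside ∷ π)  p = atT-lookupT t₁ π p

at-∷ : (t : RTree d) (π : Subset d) (p : List (Subset d)) → at t (π ∷ p) ≡ (child t π >>= λ c → at c p)
at-∷ (mk l ch) = atT-lookupT ch

at-∷⁻ : (t : RTree d) (π : Subset d) (p : List (Subset d)) {u : RTree d} → at t (π ∷ p) ≡ just u →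
        ∃ λ c → child t π ≡ just c × at c p ≡ just u
at-∷⁻ t π p t→u = >>=≡just⁻ (child t π) (trans (sym (at-∷ t π p)) t→u)

at-child : (t : RTree d) {π : Subset d} {c : RTree d} (p : List (Subset d)) →
           child t π ≡ just c → at t (π ∷ p) ≡ at c p
at-child t {π} p t→c = trans (at-∷ t π p) (cong (_>>= λ c → at c p) t→c)

at-++-child : (t : RTree d) (p : List (Subset d)) (σ : Subset d) {u c : RTree d} →
              at t p ≡ just u → child u σ ≡ just c → at t (p ++ σ ∷ []) ≡ just c
at-++-child t []      σ refl u→c = at-child t [] u→c
at-++-child t (π ∷ p) σ t→u  u→c with at-∷⁻ t π p t→u
... | c′ , t→c′ , c′→u = trans (at-child t (p ++ σ ∷ []) t→c′) (at-++-child c′ p σ c′→u u→c)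

extendDir : Subset d → Subset (suc d)
extendDir π = π ∷ʳ outside

extendDir-injective : Injective _≡_ _≡_ (extendDir {d})
extendDir-injective = ∷ʳ-injectiveˡ _ _

-- A trie branches on the coordinates in order, so the last coordinate is decided at its innermost
-- level, whose left leaf stands for the directions without it.
mutual
  extend : Maybe ℕ → RTree d → RTree (suc d)
  extend a (mk l ch) = mk (l ∷ʳ a) (extendT ch)

  extendT : Trie (Maybe (RTree d)) n → Trie (Maybe (RTree (suc d))) (suc n)
  extendT (leaf nothing)  = node (leaf nothing) (leaf nothing)
  extendT (leaf (just c)) = node (leaf (just (extend nothing c))) (leaf nothing)
  extendT (node t₀ t₁)    = node (extendT t₀) (extendT t₁)

mutual
  restrict : RTree (suc d) → RTree d
  restrict (mk l ch) = mk (init l) (restrictT ch)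

  restrictT : Trie (Maybe (RTree (suc d))) (suc n) → Trie (Maybe (RTree d)) n
  restrictT {n = zero}  (node (leaf nothing)  _) = leaf nothing
  restrictT {n = zero}  (node (leaf (just c)) _) = leaf (just (restrict c))
  restrictT {n = suc n} (node t₀ t₁)             = node (restrictT t₀) (restrictT t₁)

label-extend : (a : Maybe ℕ) (t : RTree d) → label (extend a t) ≡ label t ∷ʳ a
label-extend a (mk l ch) = refl

label-restrict : (t : RTree (suc d)) → label (restrict t) ≡ init (label t)
label-restrict (mk l ch) = refl

lookup-extend-inject₁ : (a : Maybe ℕ) (t : RTree d) (j : Fin d) →
                        lookup (label (extend a t)) (inject₁ j) ≡ lookup (label t) j
lookup-extend-inject₁ a (mk l ch) = lookup-∷ʳ-inject₁ l a

lookup-extend-fromℕ : (a : Maybe ℕ) (t : RTree d) → lookup (label (extend a t)) (fromℕ d) ≡ a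
lookup-extend-fromℕ a (mk l ch) = lookup-∷ʳ-fromℕ l a

lookup-restrict : (t : RTree (suc d)) (i : Fin d) →
                  lookup (label (restrict t)) i ≡ lookup (label t) (inject₁ i)
lookup-restrict (mk l ch) = lookup-init l

lookupT-extendT : (ch : Trie (Maybe (RTree d)) n) (π : Subset n) →
                  lookupT (extendT ch) (extendDir π) ≡ mapᵐ (extend nothing) (lookupT ch π)
lookupT-extendT (leaf nothing)  []            = refl
lookupT-extendT (leaf (just c)) []            = refl
lookupT-extendT (node t₀ t₁)    (outside ∷ π) = lookupT-extendT t₀ π
lookupT-extendT (node t₀ t₁)    (inside ∷ π)  = lookupT-extendT t₁ π

lookupT-extendT⁻ : (ch : Trie (Maybe (RTree d)) n) (σ : Subset (suc n)) {c : RTree (suc d)} →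
                   lookupT (extendT ch) σ ≡ just c →
                   ∃₂ λ π c′ → σ ≡ extendDir π × lookupT ch π ≡ just c′ × c ≡ extend nothing c′
lookupT-extendT⁻ (leaf nothing)   (outside ∷ []) ()
lookupT-extendT⁻ (leaf (just c′)) (outside ∷ []) refl = [] , c′ , refl , refl , refl
lookupT-extendT⁻ (node t₀ t₁)     (outside ∷ σ)  eq with lookupT-extendT⁻ t₀ σ eq
... | π , c′ , refl , eq′ , refl = outside ∷ π , c′ , refl , eq′ , refl
lookupT-extendT⁻ (node t₀ t₁)     (inside ∷ σ)   eq with lookupT-extendT⁻ t₁ σ eq
... | π , c′ , refl , eq′ , refl = inside ∷ π , c′ , refl , eq′ , refl

child-extend : (a : Maybe ℕ) (t : RTree d) (π : Subset d) →
               child (extend a t) (extendDir π) ≡ mapᵐ (extend nothing) (child t π)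
child-extend a (mk l ch) = lookupT-extendT ch

child-extend⁻ : (a : Maybe ℕ) (t : RTree d) (σ : Subset (suc d)) {c : RTree (suc d)} →
                child (extend a t) σ ≡ just c →
                ∃₂ λ π c′ → σ ≡ extendDir π × child t π ≡ just c′ × c ≡ extend nothing c′
child-extend⁻ a (mk l ch) = lookupT-extendT⁻ ch

lookupT-restrictT : (ch : Trie (Maybe (RTree (suc d))) (suc n)) (π : Subset n) →
                    lookupT (restrictT ch) π ≡ mapᵐ restrict (lookupT ch (extendDir π))
lookupT-restrictT {n = zero}  (node (leaf nothing)  _) []            = refl
lookupT-restrictT {n = zero}  (node (leaf (just c)) _) []            = refl
lookupT-restrictT {n = suc n} (node t₀ t₁)             (outside ∷ π) = lookupT-restrictT t₀ π
lookupT-restrictT {n = suc n} (node t₀ t₁)             (inside ∷ π)  = lookupT-restrictT t₁ π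

child-restrict : (t : RTree (suc d)) (π : Subset d) →
                 child (restrict t) π ≡ mapᵐ restrict (child t (extendDir π))
child-restrict (mk l ch) = lookupT-restrictT ch

mutual
  restrict-extend : (a : Maybe ℕ) (t : RTree d) → restrict (extend a t) ≡ t
  restrict-extend a (mk l ch) = cong₂ mk (init-∷ʳ a l) (restrictT-extendT ch)

  restrictT-extendT : (ch : Trie (Maybe (RTree d)) n) → restrictT (extendT ch) ≡ ch
  restrictT-extendT (leaf nothing)  = refl
  restrictT-extendT (leaf (just c)) = cong (leaf ∘ just) (restrict-extend nothing c)
  restrictT-extendT (node t₀ t₁)    = cong₂ node (restrictT-extendT t₀) (restrictT-extendT t₁)

at-restrict : (t : RTree (suc d)) (p : List (Subset d)) →
              at (restrict t) p ≡ mapᵐ restrict (at t (mapˡ extendDir p))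
at-restrict t []      = refl
at-restrict t (π ∷ p) = begin
  at (restrict t) (π ∷ p)
    ≡⟨ at-∷ (restrict t) π p ⟩
  (child (restrict t) π >>= λ c → at c p)
    ≡⟨ cong (_>>= λ c → at c p) (child-restrict t π) ⟩
  (mapᵐ restrict (child t (extendDir π)) >>= λ c → at c p)
    ≡⟨ at-restrict-children (child t (extendDir π)) ⟩
  mapᵐ restrict (child t (extendDir π) >>= λ c → at c p⁺)
    ≡⟨ cong (mapᵐ restrict) (at-∷ t (extendDir π) p⁺) ⟨
  mapᵐ restrict (at t (extendDir π ∷ p⁺))
    ∎
  where
  open ≡-Reasoning
  p⁺ : List (Subset (suc _))
  p⁺ = mapˡ extendDir p
  at-restrict-children : (m : Maybe (RTree (suc _))) →
                         (mapᵐ restrict m >>= λ c → at c p) ≡ mapᵐ restrict (m >>= λ c → at c p⁺)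
  at-restrict-children nothing  = refl
  at-restrict-children (just c) = at-restrict c p

at-restrict⁻ : (t : RTree (suc d)) (p : List (Subset d)) {u : RTree d} → at (restrict t) p ≡ just u →
               ∃ λ u⁺ → at t (mapˡ extendDir p) ≡ just u⁺ × restrict u⁺ ≡ u
at-restrict⁻ t p t⁻→u = map≡just⁻ restrict _ (trans (sym (at-restrict t p)) t⁻→u)

ifRoot : Maybe ℕ → List A → Maybe ℕ
ifRoot a []      = a
ifRoot a (_ ∷ _) = nothing

ifRoot-nothing : (p : List A) → ifRoot nothing p ≡ nothing
ifRoot-nothing []      = refl
ifRoot-nothing (_ ∷ _) = refl

ifRoot≡just⁻ : {a b : ℕ} (p : List A) → ifRoot (just a) p ≡ just b → p ≡ [] × a ≡ b
ifRoot≡just⁻ [] refl = refl , refl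

at-extend : (a : Maybe ℕ) (t : RTree d) (p : List (Subset d)) {u : RTree d} → at t p ≡ just u →
            at (extend a t) (mapˡ extendDir p) ≡ just (extend (ifRoot a p) u)
at-extend a t []      refl = refl
at-extend a t (π ∷ p) t→u with at-∷⁻ t π p t→u
... | c , t→c , c→u = begin
  at (extend a t) (extendDir π ∷ mapˡ extendDir p)  ≡⟨ at-child (extend a t) _ t⁺→c⁺ ⟩
  at (extend nothing c) (mapˡ extendDir p)          ≡⟨ at-extend nothing c p c→u ⟩
  just (extend (ifRoot nothing p) _)                ≡⟨ cong (λ b → just (extend b _)) (ifRoot-nothing p) ⟩
  just (extend nothing _)                           ∎
  where
  open ≡-Reasoning
  t⁺→c⁺ : child (extend a t) (extendDir π) ≡ just (extend nothing c)
  t⁺→c⁺ = trans (child-extend a t π) (cong (mapᵐ (extend nothing)) t→c)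

at-extend⁻ : (a : Maybe ℕ) (t : RTree d) (p : List (Subset (suc d))) {u : RTree (suc d)} →
             at (extend a t) p ≡ just u →
             ∃₂ λ p′ u′ → p ≡ mapˡ extendDir p′ × at t p′ ≡ just u′ × u ≡ extend (ifRoot a p′) u′
at-extend⁻ a t []      refl = [] , t , refl , refl , refl
at-extend⁻ a t (σ ∷ p) t⁺→u with at-∷⁻ (extend a t) σ p t⁺→u
... | c , t⁺→c , c→u with child-extend⁻ a t σ t⁺→c
... | π , c′ , refl , t→c′ , refl with at-extend⁻ nothing c′ p c→u
... | p′ , u′ , refl , c′→u′ , refl =
  π ∷ p′ , u′ , refl , trans (at-child t p′ t→c′) c′→u′ ,
  cong (λ b → extend b u′) (ifRoot-nothing p′)

at-extend-last : (a : ℕ) (t : RTree d) (p : List (Subset (suc d))) {u : RTree (suc d)} {b : ℕ} →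
                 at (extend (just a) t) p ≡ just u → lookup (label u) (fromℕ d) ≡ just b → p ≡ [] × a ≡ b
at-extend-last a t p t⁺→u u[d]≡b with at-extend⁻ (just a) t p t⁺→u
... | p′ , u′ , refl , _ , refl with ifRoot≡just⁻ p′ (trans (sym (lookup-extend-fromℕ _ u′)) u[d]≡b)
... | refl , a≡b = refl , a≡b

NoLastDirection : RTree (suc d) → Set
NoLastDirection t = ∀ p {u} π → at t p ≡ just u → child u (π ∷ʳ inside) ≡ nothing

NoLastDirection-child : {t c : RTree (suc d)} {σ : Subset (suc d)} → NoLastDirection t → child t σ ≡ just c →
                        NoLastDirection c
NoLastDirection-child {t = t} {σ = σ} noLast t→c p π c→u =
  noLast (σ ∷ p) π (trans (at-child t p t→c) c→u)

path-extendDir : (t : RTree (suc d)) → NoLastDirection t → ∀ p {u} → at t p ≡ just u →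
                 ∃ λ p′ → p ≡ mapˡ extendDir p′
path-extendDir t noLast []      t→u = [] , refl
path-extendDir t noLast (σ ∷ p) t→u with at-∷⁻ t σ p t→u
... | c , t→c , c→u with initLast σ
... | π , inside , refl with trans (sym t→c) (noLast [] π refl)
...   | ()
path-extendDir t noLast (σ ∷ p) t→u | c , t→c , c→u | π , outside , refl
  with path-extendDir c (NoLastDirection-child noLast t→c) p c→u
...   | p′ , refl = π ∷ p′ , refl

record LastEntryAtRootOnly (t : RTree (suc d)) : Set where
  field
    child-last≡nothing : ∀ p {u} σ {c} → at t p ≡ just u → child u σ ≡ just c → last (label c) ≡ nothing
    noLastDirection    : NoLastDirection t

LastEntryAtRootOnly-child : {t c : RTree (suc d)} {σ : Subset (suc d)} →
                            LastEntryAtRootOnly t → child t σ ≡ just c → LastEntryAtRootOnly c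
LastEntryAtRootOnly-child {t = t} {σ = σ} rootOnly t→c = record
  { child-last≡nothing = λ p ρ c→u → child-last≡nothing (σ ∷ p) ρ (trans (at-child t p t→c) c→u)
  ; noLastDirection    = NoLastDirection-child noLastDirection t→c
  }
  where open LastEntryAtRootOnly rootOnly

mutual
  extend-restrict : (t : RTree (suc d)) → LastEntryAtRootOnly t → extend (last (label t)) (restrict t) ≡ t
  extend-restrict (mk l ch) rootOnly = cong₂ mk (init-∷ʳ-last l) (extendT-restrictT ch subtrees noInside)
    where
    open LastEntryAtRootOnly rootOnly
    subtrees : ∀ σ {c} → lookupT ch (σ ∷ʳ outside) ≡ just c →
               LastEntryAtRootOnly c × last (label c) ≡ nothing
    subtrees σ ch→c = LastEntryAtRootOnly-child rootOnly ch→c , child-last≡nothing [] _ refl ch→c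
    noInside : ∀ σ → lookupT ch (σ ∷ʳ inside) ≡ nothing
    noInside σ = noLastDirection [] σ refl

  extendT-restrictT : (ch : Trie (Maybe (RTree (suc d))) (suc n)) →
                      (∀ σ {c} → lookupT ch (σ ∷ʳ outside) ≡ just c →
                                 LastEntryAtRootOnly c × last (label c) ≡ nothing) →
                      (∀ σ → lookupT ch (σ ∷ʳ inside) ≡ nothing) →
                      extendT (restrictT ch) ≡ ch
  extendT-restrictT {n = zero} (node (leaf nothing) (leaf b)) subtrees noInside =
    cong (node (leaf nothing) ∘ leaf) (sym (noInside []))
  extendT-restrictT {n = zero} (node (leaf (just c)) (leaf b)) subtrees noInside
    with subtrees [] refl
  ... | rootOnly , last≡nothing =
    cong₂ (λ c′ b′ → node (leaf (just c′)) (leaf b′)) extend-restrict-c (sym (noInside []))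
    where
    extend-restrict-c : extend nothing (restrict c) ≡ c
    extend-restrict-c = subst (λ a → extend a (restrict c) ≡ c) last≡nothing (extend-restrict c rootOnly)
  extendT-restrictT {n = suc n} (node t₀ t₁) subtrees noInside =
    cong₂ node (extendT-restrictT t₀ (subtrees ∘ (outside ∷_)) (noInside ∘ (outside ∷_)))
               (extendT-restrictT t₁ (subtrees ∘ (inside ∷_)) (noInside ∘ (inside ∷_)))

HasDirection : RTree d → Subset d → Set
HasDirection c π = ∀ i → (i ∈ π → ∃ λ a → lookup (label c) i ≡ just a) ×
                         (i ∉ π → lookup (label c) i ≡ nothing)

HasDirection-extend : {c : RTree d} {π : Subset d} → HasDirection c π →
                      HasDirection (extend nothing c) (extendDir π)
HasDirection-extend {c = c} {π} dir i with injectOrLast i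
... | injected j = map₂ (trans (lookup-extend-inject₁ nothing c j)) ∘ proj₁ (dir j) ∘ ∈-∷ʳ-inject₁⁻ π outside j
                 , λ j∉ → trans (lookup-extend-inject₁ nothing c j)
                                (proj₂ (dir j) (j∉ ∘ ∈-∷ʳ-inject₁⁺ π outside j))
... | lastIndex  = ⊥-elim ∘ fromℕ∉-∷ʳ-outside π , λ _ → lookup-extend-fromℕ nothing c

HasDirection-restrict : {c : RTree (suc d)} {π : Subset d} → HasDirection c (extendDir π) →
                        HasDirection (restrict c) π
HasDirection-restrict {c = c} {π} dir i =
    map₂ (trans (lookup-restrict c i)) ∘ proj₁ (dir (inject₁ i)) ∘ ∈-∷ʳ-inject₁⁺ π outside i
  , λ i∉ → trans (lookup-restrict c i) (proj₂ (dir (inject₁ i)) (i∉ ∘ ∈-∷ʳ-inject₁⁻ π outside i))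

Occurs : RTree d → Fin d → ℕ → Set
Occurs t i a = ∃₂ λ p u → at t p ≡ just u × lookup (label u) i ≡ just a

occurs-extend : (b : Maybe ℕ) {t : RTree d} {j : Fin d} {a : ℕ} →
                Occurs t j a → Occurs (extend b t) (inject₁ j) a
occurs-extend b {t} {j} (p , u , t→u , u[j]≡a) =
  mapˡ extendDir p , _ , at-extend b t p t→u , trans (lookup-extend-inject₁ _ u j) u[j]≡a

occurs-extend⁻ : (b : Maybe ℕ) {t : RTree d} {j : Fin d} {a : ℕ} →
                 Occurs (extend b t) (inject₁ j) a → Occurs t j a
occurs-extend⁻ b {t} {j} (p , u , t⁺→u , u[j]≡a) with at-extend⁻ b t p t⁺→u
... | p′ , u′ , refl , t→u′ , refl = p′ , u′ , t→u′ , trans (sym (lookup-extend-inject₁ _ u′ j)) u[j]≡a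

occurs-restrict : {t : RTree (suc d)} {i : Fin d} {a : ℕ} → NoLastDirection t →
                  Occurs t (inject₁ i) a → Occurs (restrict t) i a
occurs-restrict {t = t} {i} noLast (p , u , t→u , u[i]≡a) with path-extendDir t noLast p t→u
... | p′ , refl =
  p′ , restrict u , trans (at-restrict t p′) (cong (mapᵐ restrict) t→u) , trans (lookup-restrict u i) u[i]≡a

occurs-restrict⁻ : {t : RTree (suc d)} {i : Fin d} {a : ℕ} →
                   Occurs (restrict t) i a → Occurs t (inject₁ i) a
occurs-restrict⁻ {t = t} {i} (p , u , t⁻→u , u[i]≡a) with at-restrict⁻ t p t⁻→u
... | u⁺ , t→u⁺ , refl = mapˡ extendDir p , u⁺ , t→u⁺ , trans (sym (lookup-restrict u⁺ i)) u[i]≡a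

occurs⇒1≤ : {t : RTree d} {i : Fin d} {a : ℕ} → NonAmbiguous d k t → Occurs t i a → 1 ≤ a
occurs⇒1≤ {i = i} {a} na = proj₁ ∘ proj₂ (proj₂ (NonAmbiguous.interval na i) a)

root-last≡1⇒LastEntryAtRootOnly : {t : RTree (suc d)} → NonAmbiguous (suc d) k t →
                                  lookup (label t) (fromℕ d) ≡ just 1 → LastEntryAtRootOnly t
root-last≡1⇒LastEntryAtRootOnly {d} {t = t} na root-last≡1 = record
  { child-last≡nothing = child-last≡nothing
  ; noLastDirection    = noLastDirection
  }
  where
  open NonAmbiguous na

  child-last≡nothing : ∀ p {u} σ {c} → at t p ≡ just u → child u σ ≡ just c → last (label c) ≡ nothing
  child-last≡nothing p {u} σ {c} t→u u→c with last (label c) in c-last≡b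
  ... | nothing = refl
  ... | just b  = ⊥-elim (<⇒≱ b<1 (occurs⇒1≤ na (q , c , t→c , c[d]≡b)))
    where
    q : List (Subset (suc d))
    q = p ++ σ ∷ []
    t→c : at t q ≡ just c
    t→c = at-++-child t p σ t→u u→c
    c[d]≡b : lookup (label c) (fromℕ d) ≡ just b
    c[d]≡b = trans (lookup-fromℕ (label c)) c-last≡b
    b<1 : b < 1
    b<1 = decreasing [] q c t (fromℕ d) 1 b refl t→c (++-[x]≢[] p σ) root-last≡1 c[d]≡b

  noLastDirection : NoLastDirection t
  noLastDirection p {u} π t→u with child u (π ∷ʳ inside) in u→c
  ... | nothing = refl
  ... | just c
    with proj₁ (proj₂ (childDir p u (π ∷ʳ inside) c t→u u→c) (fromℕ d)) (fromℕ∈-∷ʳ-inside π)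
  ...   | a , c[d]≡a
    with trans (sym c[d]≡a) (trans (lookup-fromℕ (label c)) (child-last≡nothing p _ t→u u→c))
  ...     | ()

module _ {t : RTree d} (na : NonAmbiguous d k t) where
  open NonAmbiguous na

  extend-nonAmbiguous : NonAmbiguous (suc d) k (extend (just 1) t)
  NonAmbiguous.rootFull extend-nonAmbiguous i with injectOrLast i
  ... | injected j = map₂ (trans (lookup-extend-inject₁ (just 1) t j)) (rootFull j)
  ... | lastIndex  = 1 , lookup-extend-fromℕ (just 1) t
  NonAmbiguous.childDir extend-nonAmbiguous p u σ c t⁺→u u→c with at-extend⁻ (just 1) t p t⁺→u
  ... | p′ , u′ , refl , t→u′ , refl with child-extend⁻ _ u′ σ u→c
  ... | π , c′ , refl , u′→c′ , refl with childDir p′ u′ π c′ t→u′ u′→c′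
  ... | ∣π∣≡k , dir = trans (∣∷ʳ-outside∣ π) ∣π∣≡k , HasDirection-extend {c = c′} dir
  NonAmbiguous.decreasing extend-nonAmbiguous p q u v i a b t⁺→v t⁺→u q≢[] v[i]≡a u[i]≡b
    with at-extend⁻ (just 1) t p t⁺→v
  ... | p′ , v′ , refl , t→v′ , refl with at-extend⁻ (just 1) t (mapˡ extendDir p′ ++ q) t⁺→u
  ... | r′ , u′ , r≡ , t→u′ , refl with map-++-split extendDir-injective p′ q r′ r≡
  ... | q′ , refl , refl with injectOrLast i
  ... | injected j = decreasing p′ q′ u′ v′ j a b t→v′ t→u′ (q≢[] ∘ cong (mapˡ extendDir))
                       (trans (sym (lookup-extend-inject₁ _ v′ j)) v[i]≡a)
                       (trans (sym (lookup-extend-inject₁ _ u′ j)) u[i]≡b)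
  ... | lastIndex  =
    ⊥-elim (q≢[] (++-conicalʳ (mapˡ extendDir p′) _ (proj₁ (at-extend-last 1 t _ t⁺→u u[i]≡b))))
  NonAmbiguous.distinct extend-nonAmbiguous i p q u v a t⁺→u t⁺→v u[i]≡a v[i]≡a with injectOrLast i
  ... | lastIndex  =
    trans (proj₁ (at-extend-last 1 t p t⁺→u u[i]≡a)) (sym (proj₁ (at-extend-last 1 t q t⁺→v v[i]≡a)))
  ... | injected j with at-extend⁻ (just 1) t p t⁺→u | at-extend⁻ (just 1) t q t⁺→v
  ...   | p′ , u′ , refl , t→u′ , refl | q′ , v′ , refl , t→v′ , refl =
    cong (mapˡ extendDir) (distinct j p′ q′ u′ v′ a t→u′ t→v′
      (trans (sym (lookup-extend-inject₁ _ u′ j)) u[i]≡a)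
      (trans (sym (lookup-extend-inject₁ _ v′ j)) v[i]≡a))
  NonAmbiguous.interval extend-nonAmbiguous i with injectOrLast i
  ... | injected j = let m , range = interval j in
    m , λ a → occurs-extend (just 1) ∘ proj₁ (range a) , proj₂ (range a) ∘ occurs-extend⁻ (just 1)
  ... | lastIndex  = 1 , λ a → occursAtRoot a , λ (p , _ , t⁺→u , u[d]≡a) →
                                 1≡a⇒bounds (proj₂ (at-extend-last 1 t p t⁺→u u[d]≡a))
    where
    occursAtRoot : ∀ a → 1 ≤ a × a ≤ 1 → Occurs (extend (just 1) t) (fromℕ d) a
    occursAtRoot a (1≤a , a≤1) rewrite ≤-antisym a≤1 1≤a = [] , _ , refl , lookup-extend-fromℕ (just 1) t

    1≡a⇒bounds : ∀ {a} → 1 ≡ a → 1 ≤ a × a ≤ 1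
    1≡a⇒bounds refl = s≤s z≤n , s≤s z≤n

module _ {t : RTree (suc d)} (na : NonAmbiguous (suc d) k t) (noLast : NoLastDirection t) where
  open NonAmbiguous na

  restrict-nonAmbiguous : NonAmbiguous d k (restrict t)
  NonAmbiguous.rootFull restrict-nonAmbiguous i = map₂ (trans (lookup-restrict t i)) (rootFull (inject₁ i))
  NonAmbiguous.childDir restrict-nonAmbiguous p u π c t⁻→u u→c with at-restrict⁻ t p t⁻→u
  ... | u⁺ , t→u⁺ , refl with map≡just⁻ restrict _ (trans (sym (child-restrict u⁺ π)) u→c)
  ... | c⁺ , u⁺→c⁺ , refl with childDir (mapˡ extendDir p) u⁺ (extendDir π) c⁺ t→u⁺ u⁺→c⁺
  ... | ∣π⁺∣≡k , dir = trans (sym (∣∷ʳ-outside∣ π)) ∣π⁺∣≡k , HasDirection-restrict {c = c⁺} dir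
  NonAmbiguous.decreasing restrict-nonAmbiguous p q u v i a b t⁻→v t⁻→u q≢[] v[i]≡a u[i]≡b
    with at-restrict⁻ t p t⁻→v | at-restrict⁻ t (p ++ q) t⁻→u
  ... | v⁺ , t→v⁺ , refl | u⁺ , t→u⁺ , refl =
    decreasing (mapˡ extendDir p) (mapˡ extendDir q) u⁺ v⁺ (inject₁ i) a b t→v⁺
      (trans (cong (at t) (sym (map-++ extendDir p q))) t→u⁺) (map≢[] q q≢[])
      (trans (sym (lookup-restrict v⁺ i)) v[i]≡a) (trans (sym (lookup-restrict u⁺ i)) u[i]≡b)
  NonAmbiguous.distinct restrict-nonAmbiguous i p q u v a t⁻→u t⁻→v u[i]≡a v[i]≡a
    with at-restrict⁻ t p t⁻→u | at-restrict⁻ t q t⁻→v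
  ... | u⁺ , t→u⁺ , refl | v⁺ , t→v⁺ , refl =
    map-injective extendDir-injective
      (distinct (inject₁ i) (mapˡ extendDir p) (mapˡ extendDir q) u⁺ v⁺ a t→u⁺ t→v⁺
      (trans (sym (lookup-restrict u⁺ i)) u[i]≡a) (trans (sym (lookup-restrict v⁺ i)) v[i]≡a))
  NonAmbiguous.interval restrict-nonAmbiguous i = let m , range = interval (inject₁ i) in
    m , λ a → occurs-restrict noLast ∘ proj₁ (range a) , proj₂ (range a) ∘ occurs-restrict⁻

module _ {w : Vec ℕ d} {t : RTree (suc d)} (withRoot : NATreeWithRoot (suc d) k (w ∷ʳ 1) t) where
  private
    root : label t ≡ map just w ∷ʳ just 1
    root = trans (proj₂ withRoot) (map-∷ʳ just 1 w)

    rootOnly : LastEntryAtRootOnly t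
    rootOnly = root-last≡1⇒LastEntryAtRootOnly (proj₁ withRoot)
                 (trans (cong (λ l → lookup l (fromℕ d)) root) (lookup-∷ʳ-fromℕ (map just w) _))

  restrict-withRoot : NATreeWithRoot d k w (restrict t)
  restrict-withRoot = restrict-nonAmbiguous (proj₁ withRoot) (LastEntryAtRootOnly.noLastDirection rootOnly)
                    , trans (label-restrict t) (trans (cong init root) (init-∷ʳ _ _))

  extend-restrict-withRoot : extend (just 1) (restrict t) ≡ t
  extend-restrict-withRoot = subst (λ a → extend a (restrict t) ≡ t)
                                   (trans (cong last root) (last-∷ʳ _ (map just w)))
                                   (extend-restrict t rootOnly)

extend-withRoot : {w : Vec ℕ d} {t : RTree d} → NATreeWithRoot d k w t →
                  NATreeWithRoot (suc d) k (w ∷ʳ 1) (extend (just 1) t)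
extend-withRoot {w = w} {t} (na , root) = extend-nonAmbiguous na , (begin
  label (extend (just 1) t)  ≡⟨ label-extend (just 1) t ⟩
  label t ∷ʳ just 1          ≡⟨ cong (_∷ʳ just 1) root ⟩
  map just w ∷ʳ just 1       ≡⟨ map-∷ʳ just 1 w ⟨
  map just (w ∷ʳ 1)          ∎)
  where open ≡-Reasoning

mainTheorem13 : ∀ (d k : ℕ) → 1 ≤ k → k ≤ d → (w : Vec ℕ d) →
    Equinumerous (NATreeWithRoot (suc d) k (w ∷ʳ 1)) (NATreeWithRoot d k w)
mainTheorem13 d k _ _ w =
    restrict
  , extend (just 1)
  , (λ t t∈ → restrict-withRoot t∈ , extend-restrict-withRoot t∈)
  , (λ t t∈ → extend-withRoot t∈ , restrict-extend (just 1) t)
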